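{- Let $\mathcal C$ be a tidy LD category and let $f$ be an elementary morphism in $\mathcal C$. (i) If the target $t(f)$ is neither an $\otimes$-product nor an $\odot$-product, then $f$ is an identity. (ii) If $t(f)$ is an $\otimes$-product, then $f$ is $\mathrm{Id}^{\otimes}$-analysable. (iii) If $t(f)$ is an $\odot$-product, then $f$ is $\mathrm{Id}^{\odot}$-analysable.
   Context: A (unitless) LD category: a category $\mathcal C$ with bifunctors $\otimes,\odot$ (no units), natural isomorphisms $\alpha_{A,B,C}:A\otimes(B\otimes C)\to(A\otimes B)\otimes C$, $\bar\alpha_{A,B,C}:A\odot(B\odot C)\to(A\odot B)\odot C$, and natural transformations $\delta^l_{A,B,C}:A\otimes(B\odot C)\to(A\otimes B)\odot C$, $\delta^r_{A,B,C}:(A\odot B)\otimes C\to A\odot(B\otimes C)$, satisfying (objects denote identities): (P1) $\alpha_{A\otimes B,C,D}\circ\alpha_{A,B,C\otimes D}=(\alpha_{A,B,C}\otimes D)\circ\alpha_{A,B\otimes C,D}\circ(A\otimes\alpha_{B,C,D})$; (P2) $\delta^l_{A\otimes B,C,D}\circ\alpha_{A,B,C\odot D}=(\alpha_{A,B,C}\odot D)\circ\delta^l_{A,B\otimes C,D}\circ(A\otimes\delta^l_{B,C,D})$; (P3) $\delta^l_{A,B,C\otimes D}\circ(A\otimes\delta^r_{B,C,D})=\delta^r_{A\otimes B,C,D}\circ(\delta^l_{A,B,C}\otimes D)\circ\alpha_{A,B\odot C,D}$; (P4) $\bar\alpha_{A\otimes B,C,D}\circ\delta^l_{A,B,C\odot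 D}=(\delta^l_{A,B,C}\odot D)\circ\delta^l_{A,B\odot C,D}\circ(A\otimes\bar\alpha_{B,C,D})$; (P5) $(A\odot\alpha_{B,C,D})\circ\delta^r_{A,B,C\otimes D}=\delta^r_{A,B\otimes C,D}\circ(\delta^r_{A,B,C}\otimes D)\circ\alpha_{A\odot B,C,D}$; (P6) $(\delta^r_{A,B,C}\odot D)\circ\delta^l_{A\odot B,C,D}=\bar\alpha_{A,B\otimes C,D}\circ(A\odot\delta^l_{B,C,D})\circ\delta^r_{A,B,C\odot D}$; (P7) $\delta^r_{A\odot B,C,D}\circ(\bar\alpha_{A,B,C}\otimes D)=\bar\alpha_{A,B,C\otimes D}\circ(A\odot\delta^r_{B,C,D})\circ\delta^r_{A,B\odot C,D}$; (P8) $\bar\alpha_{A\odot B,C,D}\circ\bar\alpha_{A,B,C\odot D}=(\bar\alpha_{A,B,C}\odot D)\circ\bar\alpha_{A,B\odot C,D}\circ(A\odot\bar\alpha_{B,C,D})$. Tidy: $A_1\otimes A_2=B_1\otimes B_2$ implies $A_i=B_i$; $A_1\odot A_2=B_1\odot B_2$ implies $A_i=B_i$; and always $A_1\otimes A_2\neq B_1\odot B_2$ (equalities of objects). An object is an $\otimes$-product (resp. $\odot$-product) if it equals $A_1\otimes A_2$ (resp. $A_1\odot A_2$) for some objects. Atomic morphisms: the smallest class containing all components of $\alpha,\alpha^{ -1},\bar\alpha,\bar\alpha^{ -1},\delta^l,\delta^r$ and closed under $f\mapsto f\otimes\mathrm{id}_A,\mathrm{id}_A\otimes f,f\odot\mathrm{id}_A,\mathrm{id}_A\odot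 f$. Elementary: an identity or a finite composite of atomic morphisms. $\mathrm{Id}^\otimes$ and $\mathrm{Id}^\odot$ are the classes of identities of $\otimes$-products and of $\odot$-products. Words: $\mathfrak Y$ is the free monoid on generators $\alpha,\alpha^{ -1}$, $\mathfrak Z$ the free monoid on $\bar\alpha,\bar\alpha^{ -1},\delta^l,\delta^r$; $|u|$ is the length; a word $gu$ ($g$ a generator) is read with $g$ applied last. For a vector $\vec A=(A_1,\dots,A_n)$ of objects write $\vec A_{\ge k}=(A_k,\dots,A_n)$, $\vec A_{\le k}=(A_1,\dots,A_k)$. For $f:H\to L\otimes R$ and $u\in\mathfrak Y$, define functors $H^f_u,L^f_u,R^f_u:\mathcal C^{|u|}\to\mathcal C$ by $H^f_\emptyset=H$, $L^f_\emptyset=L$, $R^f_\emptyset=R$; $H^f_{\alpha u}(\vec A)=A_1\otimes H^f_u(\vec A_{\ge2})$, $L^f_{\alpha u}(\vec A)=A_1\otimes L^f_u(\vec A_{\ge2})$, $R^f_{\alpha u}(\vec A)=R^f_u(\vec A_{\ge2})$; $H^f_{\alpha^{ -1}u}(\vec A)=H^f_u(\vec A_{\le|u|})\otimes A_{|u|+1}$, $L^f_{\alpha^{ -1}u}(\vec A)=L^f_u(\vec A_{\le|u|})$, $R^f_{\alpha^{ -1}u}(\vec A)=R^f_u(\vec A_{\le|u|})\otimes A_{|u|+1}$; and natural transformations $\tau^f_u:H^f_u\to L^f_u\otimes R^f_u$ by $\tau^f_\emptyset=f$, $\tau^f_{\alpha u}=\alpha\circ(\mathrm{id}\otimes\tau^f_u)$,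 $\tau^f_{\alpha^{ -1}u}=\alpha^{ -1}\circ(\tau^f_u\otimes\mathrm{id})$ (with the evident components). For $f:H\to L\odot R$ and $u\in\mathfrak Z$, define $H^f_u,L^f_u,R^f_u$ with the same base case and: $\bar\alpha u$ as $\alpha u$ above but with $\odot$ in place of $\otimes$; $\bar\alpha^{ -1}u$ as $\alpha^{ -1}u$ with $\odot$ in place of $\otimes$; $\delta^l u$ exactly as $\alpha u$ (with $\otimes$); $\delta^r u$ exactly as $\alpha^{ -1}u$ (with $\otimes$). Define $\kappa^f_u:H^f_u\to L^f_u\odot R^f_u$ by $\kappa^f_\emptyset=f$, $\kappa^f_{\bar\alpha u}=\bar\alpha\circ(\mathrm{id}\odot\kappa^f_u)$, $\kappa^f_{\bar\alpha^{ -1}u}=\bar\alpha^{ -1}\circ(\kappa^f_u\odot\mathrm{id})$, $\kappa^f_{\delta^lu}=\delta^l\circ(\mathrm{id}\otimes\kappa^f_u)$, $\kappa^f_{\delta^ru}=\delta^r\circ(\kappa^f_u\otimes\mathrm{id})$. For a set $\mathfrak f$ of morphisms with $\otimes$-product targets, a morphism $g$ is $\mathfrak f$-analysable if $g=(g'\otimes g'')\circ\tau^f_u(\vec A)$ for some morphisms $g',g''$, some $f\in\mathfrak f$, $u\in\mathfrak Y$, $\vec A\in\mathcal C^{|u|}$. For a set $\mathfrak f$ of morphisms with $\odot$-product targets, $g$ is $\mathfrak f$-analysable if $g=(g'\odot g'')\circ\kappa^f_u(\vec A)$ with $f\in\mathfrak f$, $u\in\mathfrak Z$, $\vec A\in\mathcal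 C^{|u|}$. -}

module Defs where

open import Level using (Level; _⊔_; suc)
open import Data.Product using (Σ; _×_; _,_; ∃-syntax)
open import Data.List using (List; []; _∷_; length)
open import Data.Vec using (Vec; []; _∷_; init; last)
open import Relation.Binary.PropositionalEquality using (_≡_; _≢_)

-- A (unitless) LD category, with set-level (propositional) equality of objects
-- and of morphisms.
record LDCat (o ℓ : Level) : Set (suc (o ⊔ ℓ)) where
  infixr 9 _∘_
  infixr 10 _⊗_ _⊙_ _⊗₁_ _⊙₁_
  field
    Obj : Set o
    Hom : Obj → Obj → Set ℓ
    id  : ∀ {A} → Hom A A
    _∘_ : ∀ {A B C} → Hom B C → Hom A B → Hom A C
    identityˡ : ∀ {A B} (f : Hom A B) → id ∘ f ≡ f
    identityʳ : ∀ {A B} (f : Hom A B) → f ∘ id ≡ f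
    assoc : ∀ {A B C D} (h : Hom C D) (g : Hom B C) (f : Hom A B) →
            (h ∘ g) ∘ f ≡ h ∘ (g ∘ f)
    _⊗_  : Obj → Obj → Obj
    _⊗₁_ : ∀ {A B C D} → Hom A B → Hom C D → Hom (A ⊗ C) (B ⊗ D)
    ⊗-id : ∀ {A B} → id {A} ⊗₁ id {B} ≡ id
    ⊗-∘  : ∀ {A B C A' B' C'} (g : Hom B C) (f : Hom A B) (g' : Hom B' C') (f' : Hom A' B') →
           (g ∘ f) ⊗₁ (g' ∘ f') ≡ (g ⊗₁ g') ∘ (f ⊗₁ f')
    _⊙_  : Obj → Obj → Obj
    _⊙₁_ : ∀ {A B C D} → Hom A B → Hom C D → Hom (A ⊙ C) (B ⊙ D)
    ⊙-id : ∀ {A B} → id {A} ⊙₁ id {B} ≡ id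
    ⊙-∘  : ∀ {A B C A' B' C'} (g : Hom B C) (f : Hom A B) (g' : Hom B' C') (f' : Hom A' B') →
           (g ∘ f) ⊙₁ (g' ∘ f') ≡ (g ⊙₁ g') ∘ (f ⊙₁ f')
    α   : ∀ A B C → Hom (A ⊗ (B ⊗ C)) ((A ⊗ B) ⊗ C)
    α⁻¹ : ∀ A B C → Hom ((A ⊗ B) ⊗ C) (A ⊗ (B ⊗ C))
    α∘α⁻¹ : ∀ A B C → α A B C ∘ α⁻¹ A B C ≡ id
    α⁻¹∘α : ∀ A B C → α⁻¹ A B C ∘ α A B C ≡ id
    α-natural : ∀ {A B C A' B' C'} (f : Hom A A') (g : Hom B B') (h : Hom C C') →
                α A' B' C' ∘ (f ⊗₁ (g ⊗₁ h)) ≡ ((f ⊗₁ g) ⊗₁ h) ∘ α A B C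
    ᾱ   : ∀ A B C → Hom (A ⊙ (B ⊙ C)) ((A ⊙ B) ⊙ C)
    ᾱ⁻¹ : ∀ A B C → Hom ((A ⊙ B) ⊙ C) (A ⊙ (B ⊙ C))
    ᾱ∘ᾱ⁻¹ : ∀ A B C → ᾱ A B C ∘ ᾱ⁻¹ A B C ≡ id
    ᾱ⁻¹∘ᾱ : ∀ A B C → ᾱ⁻¹ A B C ∘ ᾱ A B C ≡ id
    ᾱ-natural : ∀ {A B C A' B' C'} (f : Hom A A') (g : Hom B B') (h : Hom C C') →
                ᾱ A' B' C' ∘ (f ⊙₁ (g ⊙₁ h)) ≡ ((f ⊙₁ g) ⊙₁ h) ∘ ᾱ A B C
    δˡ : ∀ A B C → Hom (A ⊗ (B ⊙ C)) ((A ⊗ B) ⊙ C)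
    δʳ : ∀ A B C → Hom ((A ⊙ B) ⊗ C) (A ⊙ (B ⊗ C))
    δˡ-natural : ∀ {A B C A' B' C'} (f : Hom A A') (g : Hom B B') (h : Hom C C') →
                 δˡ A' B' C' ∘ (f ⊗₁ (g ⊙₁ h)) ≡ ((f ⊗₁ g) ⊙₁ h) ∘ δˡ A B C
    δʳ-natural : ∀ {A B C A' B' C'} (f : Hom A A') (g : Hom B B') (h : Hom C C') →
                 δʳ A' B' C' ∘ ((f ⊙₁ g) ⊗₁ h) ≡ (f ⊙₁ (g ⊗₁ h)) ∘ δʳ A B C
    P1 : ∀ A B C D → α (A ⊗ B) C D ∘ α A B (C ⊗ D)
         ≡ (α A B C ⊗₁ id {D}) ∘ α A (B ⊗ C) D ∘ (id {A} ⊗₁ α B C D)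
    P2 : ∀ A B C D → δˡ (A ⊗ B) C D ∘ α A B (C ⊙ D)
         ≡ (α A B C ⊙₁ id {D}) ∘ δˡ A (B ⊗ C) D ∘ (id {A} ⊗₁ δˡ B C D)
    P3 : ∀ A B C D → δˡ A B (C ⊗ D) ∘ (id {A} ⊗₁ δʳ B C D)
         ≡ δʳ (A ⊗ B) C D ∘ (δˡ A B C ⊗₁ id {D}) ∘ α A (B ⊙ C) D
    P4 : ∀ A B C D → ᾱ (A ⊗ B) C D ∘ δˡ A B (C ⊙ D)
         ≡ (δˡ A B C ⊙₁ id {D}) ∘ δˡ A (B ⊙ C) D ∘ (id {A} ⊗₁ ᾱ B C D)
    P5 : ∀ A B C D → (id {A} ⊙₁ α B C D) ∘ δʳ A B (C ⊗ D)
         ≡ δʳ A (B ⊗ C) D ∘ (δʳ A B C ⊗₁ id {D}) ∘ α (A ⊙ B) C D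
    P6 : ∀ A B C D → (δʳ A B C ⊙₁ id {D}) ∘ δˡ (A ⊙ B) C D
         ≡ ᾱ A (B ⊗ C) D ∘ (id {A} ⊙₁ δˡ B C D) ∘ δʳ A B (C ⊙ D)
    P7 : ∀ A B C D → δʳ (A ⊙ B) C D ∘ (ᾱ A B C ⊗₁ id {D})
         ≡ ᾱ A B (C ⊗ D) ∘ (id {A} ⊙₁ δʳ B C D) ∘ δʳ A (B ⊙ C) D
    P8 : ∀ A B C D → ᾱ (A ⊙ B) C D ∘ ᾱ A B (C ⊙ D)
         ≡ (ᾱ A B C ⊙₁ id {D}) ∘ ᾱ A (B ⊙ C) D ∘ (id {A} ⊙₁ ᾱ B C D)

record Tidy {o ℓ : Level} (𝒞 : LDCat o ℓ) : Set o where
  open LDCat 𝒞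
  field
    ⊗-inj : ∀ {A₁ A₂ B₁ B₂} → A₁ ⊗ A₂ ≡ B₁ ⊗ B₂ → (A₁ ≡ B₁) × (A₂ ≡ B₂)
    ⊙-inj : ∀ {A₁ A₂ B₁ B₂} → A₁ ⊙ A₂ ≡ B₁ ⊙ B₂ → (A₁ ≡ B₁) × (A₂ ≡ B₂)
    ⊗≢⊙   : ∀ {A₁ A₂ B₁ B₂} → A₁ ⊗ A₂ ≢ B₁ ⊙ B₂

-- Generators of the free monoids 𝔜 and 𝔷 (words are lists, head = applied last)
data YGen : Set where
  gα gα⁻¹ : YGen

data ZGen : Set where
  gᾱ gᾱ⁻¹ gδˡ gδʳ : ZGen

module LDTheory {o ℓ : Level} (𝒞 : LDCat o ℓ) where
  open LDCat 𝒞

  data IsId : ∀ {A B} → Hom A B → Set (o ⊔ ℓ) where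
    isId : ∀ {A} → IsId (id {A})

  IsOtimesProduct : Obj → Set o
  IsOtimesProduct X = Σ Obj λ A₁ → Σ Obj λ A₂ → X ≡ A₁ ⊗ A₂

  IsOdotProduct : Obj → Set o
  IsOdotProduct X = Σ Obj λ A₁ → Σ Obj λ A₂ → X ≡ A₁ ⊙ A₂

  data Atomic : ∀ {A B} → Hom A B → Set (o ⊔ ℓ) where
    at-α   : ∀ A B C → Atomic (α A B C)
    at-α⁻¹ : ∀ A B C → Atomic (α⁻¹ A B C)
    at-ᾱ   : ∀ A B C → Atomic (ᾱ A B C)
    at-ᾱ⁻¹ : ∀ A B C → Atomic (ᾱ⁻¹ A B C)
    at-δˡ  : ∀ A B C → Atomic (δˡ A B C)
    at-δʳ  : ∀ A B C → Atomic (δʳ A B C)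
    at-⊗ʳ  : ∀ {A B} {f : Hom A B} X → Atomic f → Atomic (f ⊗₁ id {X})
    at-⊗ˡ  : ∀ {A B} {f : Hom A B} X → Atomic f → Atomic (id {X} ⊗₁ f)
    at-⊙ʳ  : ∀ {A B} {f : Hom A B} X → Atomic f → Atomic (f ⊙₁ id {X})
    at-⊙ˡ  : ∀ {A B} {f : Hom A B} X → Atomic f → Atomic (id {X} ⊙₁ f)

  data Elementary : ∀ {A B} → Hom A B → Set (o ⊔ ℓ) where
    el-id : ∀ {A} → Elementary (id {A})
    el-∘  : ∀ {A B C} {g : Hom B C} {f : Hom A B} → Atomic g → Elementary f → Elementary (g ∘ f)

  HY : Obj → (u : List YGen) → Vec Obj (length u) → Obj
  HY H []         []       = H
  HY H (gα ∷ u)   (A ∷ As) = A ⊗ HY H u As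
  HY H (gα⁻¹ ∷ u) As       = HY H u (init As) ⊗ last As

  LY : Obj → (u : List YGen) → Vec Obj (length u) → Obj
  LY L []         []       = L
  LY L (gα ∷ u)   (A ∷ As) = A ⊗ LY L u As
  LY L (gα⁻¹ ∷ u) As       = LY L u (init As)

  RY : Obj → (u : List YGen) → Vec Obj (length u) → Obj
  RY R []         []       = R
  RY R (gα ∷ u)   (A ∷ As) = RY R u As
  RY R (gα⁻¹ ∷ u) As       = RY R u (init As) ⊗ last As

  τ : ∀ {H L R} (f : Hom H (L ⊗ R)) (u : List YGen) (As : Vec Obj (length u)) →
      Hom (HY H u As) (LY L u As ⊗ RY R u As)
  τ f []         []       = f
  τ {H} {L} {R} f (gα ∷ u) (A ∷ As) =
    α A (LY L u As) (RY R u As) ∘ (id {A} ⊗₁ τ f u As)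
  τ {H} {L} {R} f (gα⁻¹ ∷ u) As =
    α⁻¹ (LY L u (init As)) (RY R u (init As)) (last As) ∘ (τ f u (init As) ⊗₁ id {last As})

  HZ : Obj → (u : List ZGen) → Vec Obj (length u) → Obj
  HZ H []         []       = H
  HZ H (gᾱ ∷ u)   (A ∷ As) = A ⊙ HZ H u As
  HZ H (gᾱ⁻¹ ∷ u) As       = HZ H u (init As) ⊙ last As
  HZ H (gδˡ ∷ u)  (A ∷ As) = A ⊗ HZ H u As
  HZ H (gδʳ ∷ u)  As       = HZ H u (init As) ⊗ last As

  LZ : Obj → (u : List ZGen) → Vec Obj (length u) → Obj
  LZ L []         []       = L
  LZ L (gᾱ ∷ u)   (A ∷ As) = A ⊙ LZ L u As
  LZ L (gᾱ⁻¹ ∷ u) As       = LZ L u (init As)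
  LZ L (gδˡ ∷ u)  (A ∷ As) = A ⊗ LZ L u As
  LZ L (gδʳ ∷ u)  As       = LZ L u (init As)

  RZ : Obj → (u : List ZGen) → Vec Obj (length u) → Obj
  RZ R []         []       = R
  RZ R (gᾱ ∷ u)   (A ∷ As) = RZ R u As
  RZ R (gᾱ⁻¹ ∷ u) As       = RZ R u (init As) ⊙ last As
  RZ R (gδˡ ∷ u)  (A ∷ As) = RZ R u As
  RZ R (gδʳ ∷ u)  As       = RZ R u (init As) ⊗ last As

  κ : ∀ {H L R} (f : Hom H (L ⊙ R)) (u : List ZGen) (As : Vec Obj (length u)) →
      Hom (HZ H u As) (LZ L u As ⊙ RZ R u As)
  κ f []         []       = f
  κ {H} {L} {R} f (gᾱ ∷ u) (A ∷ As) =
    ᾱ A (LZ L u As) (RZ R u As) ∘ (id {A} ⊙₁ κ f u As)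
  κ {H} {L} {R} f (gᾱ⁻¹ ∷ u) As =
    ᾱ⁻¹ (LZ L u (init As)) (RZ R u (init As)) (last As) ∘ (κ f u (init As) ⊙₁ id {last As})
  κ {H} {L} {R} f (gδˡ ∷ u) (A ∷ As) =
    δˡ A (LZ L u As) (RZ R u As) ∘ (id {A} ⊗₁ κ f u As)
  κ {H} {L} {R} f (gδʳ ∷ u) As =
    δʳ (LZ L u (init As)) (RZ R u (init As)) (last As) ∘ (κ f u (init As) ⊗₁ id {last As})

  data Analysable⊗ {p : Level} (𝔣 : ∀ {H L R} → Hom H (L ⊗ R) → Set p) :
       ∀ {X Y} → Hom X Y → Set (o ⊔ ℓ ⊔ p) where
    analyse : ∀ {H L R} (f : Hom H (L ⊗ R)) → 𝔣 f →
              (u : List YGen) (As : Vec Obj (length u)) {C D : Obj}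
              (g′ : Hom (LY L u As) C) (g″ : Hom (RY R u As) D) →
              Analysable⊗ 𝔣 ((g′ ⊗₁ g″) ∘ τ f u As)

  data Analysable⊙ {p : Level} (𝔣 : ∀ {H L R} → Hom H (L ⊙ R) → Set p) :
       ∀ {X Y} → Hom X Y → Set (o ⊔ ℓ ⊔ p) where
    analyse : ∀ {H L R} (f : Hom H (L ⊙ R)) → 𝔣 f →
              (u : List ZGen) (As : Vec Obj (length u)) {C D : Obj}
              (g′ : Hom (LZ L u As) C) (g″ : Hom (RZ R u As) D) →
              Analysable⊙ 𝔣 ((g′ ⊙₁ g″) ∘ κ f u As)

  Id⊗ : ∀ {H L R} → Hom H (L ⊗ R) → Set (o ⊔ ℓ)
  Id⊗ f = IsId f

  Id⊙ : ∀ {H L R} → Hom H (L ⊙ R) → Set (o ⊔ ℓ)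
  Id⊙ f = IsId f

-- An elementary f into C ⊗ D is id ∘ a₁ ∘ ⋯ ∘ aₙ with atoms aᵢ, and id = (id ⊗ id) ∘ τ^{id}_∅.
-- So it suffices that the form (g′ ⊗ g″) ∘ τ^{id}_u survives precomposition with an atom a,
-- for a new word u and new g′, g″.  By tidiness the target of a can match the source of
-- τ^{id}_u only in a few ways: a acts on one argument of u (naturality), or on the rest of
-- the source (recursion on a, then naturality of the first letter), or on the first one or
-- two letters of u at once; in the last case one of (P1)–(P8), with α, ᾱ possibly inverted,
-- rewrites τ^{id}_u ∘ a as (k′ ⊗ k″) ∘ τ^{id}_{u′}.  The ⊙ case is the same with words in 𝔷.
-- Every atom has a product as target, so an elementary morphism into a non-product is an
-- identity.

module Submission where

open import Level using (Level; _⊔_)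
open import Data.Product using (_×_; _,_; Σ-syntax; uncurry)
open import Data.Sum using (_⊎_; inj₁; inj₂)
open import Data.Empty using (⊥-elim)
open import Data.List using (List; []; _∷_; length)
open import Data.Vec using (Vec; []; _∷_; _∷ʳ_)
open import Data.Vec.Properties using (init-∷ʳ; last-∷ʳ)
open import Relation.Nullary using (¬_)
open import Relation.Binary.PropositionalEquality
  using (_≡_; refl; sym; trans; cong; cong₂; subst; module ≡-Reasoning)

open import Defs

module LDCategoryProperties {o ℓ : Level} (𝒞 : LDCat o ℓ) where
  open LDCat 𝒞
  open LDTheory 𝒞 using (Atomic; Elementary; el-id; el-∘)
  open ≡-Reasoning

  cancelˡ : ∀ {A B C} {f : Hom B A} {f⁻ : Hom A B} {h : Hom C B} →
            f⁻ ∘ f ≡ id → f⁻ ∘ (f ∘ h) ≡ h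
  cancelˡ {f = f} {f⁻} {h} inverse = begin
    f⁻ ∘ (f ∘ h)  ≡⟨ sym (assoc f⁻ f h) ⟩
    (f⁻ ∘ f) ∘ h  ≡⟨ cong (_∘ h) inverse ⟩
    id ∘ h        ≡⟨ identityˡ h ⟩
    h             ∎

  ∘-inverse : ∀ {A B C} {f : Hom B C} {f⁻ : Hom C B} {g : Hom A B} {g⁻ : Hom B A} →
              f⁻ ∘ f ≡ id → g⁻ ∘ g ≡ id → (g⁻ ∘ f⁻) ∘ (f ∘ g) ≡ id
  ∘-inverse {f = f} {f⁻} {g} {g⁻} f-inverse g-inverse = begin
    (g⁻ ∘ f⁻) ∘ (f ∘ g)  ≡⟨ assoc g⁻ f⁻ (f ∘ g) ⟩
    g⁻ ∘ (f⁻ ∘ (f ∘ g))  ≡⟨ cong (g⁻ ∘_) (cancelˡ f-inverse) ⟩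
    g⁻ ∘ g               ≡⟨ g-inverse ⟩
    id                   ∎

  glue : ∀ {A B B′ C E} {i : Hom A B} {f : Hom B B′} {i′ : Hom C B′} {g : Hom A C}
           {x : Hom B′ E} {z : Hom C E} →
         f ∘ i ≡ i′ ∘ g → x ∘ i′ ≡ z → (x ∘ f) ∘ i ≡ z ∘ g
  glue {i = i} {f} {i′} {g} {x} {z} square triangle = begin
    (x ∘ f) ∘ i   ≡⟨ assoc x f i ⟩
    x ∘ (f ∘ i)   ≡⟨ cong (x ∘_) square ⟩
    x ∘ (i′ ∘ g)  ≡⟨ sym (assoc x i′ g) ⟩
    (x ∘ i′) ∘ g  ≡⟨ cong (_∘ g) triangle ⟩
    z ∘ g         ∎

  flip-square : ∀ {A B C D} {i : Hom A B} {i⁻ : Hom B A} {j : Hom C D} {j⁻ : Hom D C}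
                  {x : Hom B D} {y : Hom A C} →
                x ∘ i ≡ j ∘ y → i ∘ i⁻ ≡ id → j⁻ ∘ j ≡ id → j⁻ ∘ x ≡ y ∘ i⁻
  flip-square {i = i} {i⁻} {j} {j⁻} {x} {y} square i-inverse j-inverse = begin
    j⁻ ∘ x                ≡⟨ sym (identityʳ _) ⟩
    (j⁻ ∘ x) ∘ id         ≡⟨ cong ((j⁻ ∘ x) ∘_) (sym i-inverse) ⟩
    (j⁻ ∘ x) ∘ (i ∘ i⁻)   ≡⟨ sym (assoc _ i i⁻) ⟩
    ((j⁻ ∘ x) ∘ i) ∘ i⁻   ≡⟨ cong (_∘ i⁻) (assoc j⁻ x i) ⟩
    (j⁻ ∘ (x ∘ i)) ∘ i⁻   ≡⟨ cong (λ h → (j⁻ ∘ h) ∘ i⁻) square ⟩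
    (j⁻ ∘ (j ∘ y)) ∘ i⁻   ≡⟨ cong (_∘ i⁻) (cancelˡ j-inverse) ⟩
    y ∘ i⁻                ∎

  flip-triangle : ∀ {A B C} {i : Hom A B} {i⁻ : Hom B A} {x : Hom B C} {y : Hom A C} →
                  x ∘ i ≡ y → i ∘ i⁻ ≡ id → x ≡ y ∘ i⁻
  flip-triangle {x = x} {y} triangle i-inverse =
    trans (sym (identityˡ x))
          (flip-square (trans triangle (sym (identityˡ y))) i-inverse (identityˡ id))

  module Bifunctor
    (_•_  : Obj → Obj → Obj)
    (_•₁_ : ∀ {A B C D} → Hom A B → Hom C D → Hom (A • C) (B • D))
    (•-id : ∀ {A B} → id {A} •₁ id {B} ≡ id)
    (•-∘  : ∀ {A B C A′ B′ C′} (g : Hom B C) (f : Hom A B) (g′ : Hom B′ C′) (f′ : Hom A′ B′) →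
            (g ∘ f) •₁ (g′ ∘ f′) ≡ (g •₁ g′) ∘ (f •₁ f′))
    where

    id•-∘ : ∀ {A B C D} (f : Hom C D) (g : Hom B C) → id {A} •₁ (f ∘ g) ≡ (id •₁ f) ∘ (id •₁ g)
    id•-∘ f g = trans (cong (_•₁ (f ∘ g)) (sym (identityˡ id))) (•-∘ id id f g)

    ∘-•id : ∀ {A B C D} (f : Hom C D) (g : Hom B C) → (f ∘ g) •₁ id {A} ≡ (f •₁ id) ∘ (g •₁ id)
    ∘-•id f g = trans (cong ((f ∘ g) •₁_) (sym (identityˡ id))) (•-∘ f g id id)

    interchange : ∀ {A B C D} (f : Hom A B) (g : Hom C D) →
                  (f •₁ id) ∘ (id •₁ g) ≡ (id •₁ g) ∘ (f •₁ id)
    interchange f g = begin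
      (f •₁ id) ∘ (id •₁ g)  ≡⟨ sym (•-∘ f id id g) ⟩
      (f ∘ id) •₁ (id ∘ g)   ≡⟨ cong₂ _•₁_ (trans (identityʳ f) (sym (identityˡ f)))
                                            (trans (identityˡ g) (sym (identityʳ g))) ⟩
      (id ∘ f) •₁ (g ∘ id)   ≡⟨ •-∘ id f g id ⟩
      (id •₁ g) ∘ (f •₁ id)  ∎

    •-inverse : ∀ {A B C D} {f : Hom B A} {g : Hom A B} {f′ : Hom D C} {g′ : Hom C D} →
                f ∘ g ≡ id → f′ ∘ g′ ≡ id → (f •₁ f′) ∘ (g •₁ g′) ≡ id
    •-inverse {f = f} {g} {f′} {g′} inverse inverse′ = begin
      (f •₁ f′) ∘ (g •₁ g′)  ≡⟨ sym (•-∘ f g f′ g′) ⟩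
      (f ∘ g) •₁ (f′ ∘ g′)   ≡⟨ cong₂ _•₁_ inverse inverse′ ⟩
      id •₁ id               ≡⟨ •-id ⟩
      id                     ∎

    module Associative
      (a   : ∀ A B C → Hom (A • (B • C)) ((A • B) • C))
      (a⁻¹ : ∀ A B C → Hom ((A • B) • C) (A • (B • C)))
      (a∘a⁻¹ : ∀ A B C → a A B C ∘ a⁻¹ A B C ≡ id)
      (a⁻¹∘a : ∀ A B C → a⁻¹ A B C ∘ a A B C ≡ id)
      (a-natural : ∀ {A B C A′ B′ C′} (f : Hom A A′) (g : Hom B B′) (h : Hom C C′) →
                   a A′ B′ C′ ∘ (f •₁ (g •₁ h)) ≡ ((f •₁ g) •₁ h) ∘ a A B C)
      (pentagon : ∀ A B C D → a (A • B) C D ∘ a A B (C • D)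
                  ≡ (a A B C •₁ id {D}) ∘ a A (B • C) D ∘ (id {A} •₁ a B C D))
      where

      a-natural₁ : ∀ {A A′ B C} (f : Hom A A′) →
                   a A′ B C ∘ (f •₁ id) ≡ ((f •₁ id) •₁ id) ∘ a A B C
      a-natural₁ f = trans (cong (λ k → a _ _ _ ∘ (f •₁ k)) (sym •-id)) (a-natural f id id)

      a-natural₃ : ∀ {A B C C′} (h : Hom C C′) →
                   a A B C′ ∘ (id •₁ (id •₁ h)) ≡ (id •₁ h) ∘ a A B C
      a-natural₃ h = trans (a-natural id id h) (cong (λ k → (k •₁ h) ∘ a _ _ _) •-id)

      a⁻¹-natural : ∀ {A B C A′ B′ C′} (f : Hom A A′) (g : Hom B B′) (h : Hom C C′) →
                    a⁻¹ A′ B′ C′ ∘ ((f •₁ g) •₁ h) ≡ (f •₁ (g •₁ h)) ∘ a⁻¹ A B C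
      a⁻¹-natural f g h = flip-square (sym (a-natural f g h)) (a∘a⁻¹ _ _ _) (a⁻¹∘a _ _ _)

      a⁻¹-natural₃ : ∀ {A B C C′} (h : Hom C C′) →
                     a⁻¹ A B C′ ∘ (id •₁ h) ≡ (id •₁ (id •₁ h)) ∘ a⁻¹ A B C
      a⁻¹-natural₃ h = trans (cong (λ k → a⁻¹ _ _ _ ∘ (k •₁ h)) (sym •-id)) (a⁻¹-natural id id h)

      -- For a = α these are the two clauses of τ: τ^f_{αu} = a-step A τ^f_u and
      -- τ^f_{α⁻¹u} = a⁻¹-step y τ^f_u.
      a-step : ∀ A {H L R} → Hom H (L • R) → Hom (A • H) ((A • L) • R)
      a-step A t = a A _ _ ∘ (id •₁ t)

      a⁻¹-step : ∀ y {H L R} → Hom H (L • R) → Hom (H • y) (L • (R • y))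
      a⁻¹-step y t = a⁻¹ _ _ y ∘ (t •₁ id)

      a-step-id : ∀ {A L R} → a-step A (id {L • R}) ≡ a A L R
      a-step-id = trans (cong (a _ _ _ ∘_) •-id) (identityʳ _)

      a⁻¹-step-id : ∀ {y L R} → a⁻¹-step y (id {L • R}) ≡ a⁻¹ L R y
      a⁻¹-step-id = trans (cong (a⁻¹ _ _ _ ∘_) •-id) (identityʳ _)

      a-step-id-∘-a⁻¹ : ∀ {P Q S} → a-step P (id {Q • S}) ∘ a⁻¹ P Q S ≡ id
      a-step-id-∘-a⁻¹ = trans (cong (_∘ a⁻¹ _ _ _) a-step-id) (a∘a⁻¹ _ _ _)

      a⁻¹-step-id-∘-a : ∀ {P Q S} → a⁻¹-step S (id {P • Q}) ∘ a P Q S ≡ id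
      a⁻¹-step-id-∘-a = trans (cong (_∘ a _ _ _) a⁻¹-step-id) (a⁻¹∘a _ _ _)

      a-step-∘ʳ : ∀ {A H H′ L R} (t : Hom H′ (L • R)) (g : Hom H H′) →
                  a-step A t ∘ (id •₁ g) ≡ a-step A (t ∘ g)
      a-step-∘ʳ t g = trans (assoc _ _ _) (cong (a _ _ _ ∘_) (sym (id•-∘ t g)))

      a⁻¹-step-∘ˡ : ∀ {y H H′ L R} (t : Hom H′ (L • R)) (g : Hom H H′) →
                    a⁻¹-step y t ∘ (g •₁ id) ≡ a⁻¹-step y (t ∘ g)
      a⁻¹-step-∘ˡ t g = trans (assoc _ _ _) (cong (a⁻¹ _ _ _ ∘_) (sym (∘-•id t g)))

      a-step-∘ˡ : ∀ {A₀ A H L R} (f : Hom A₀ A) (t : Hom H (L • R)) →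
                  a-step A t ∘ (f •₁ id) ≡ ((f •₁ id) •₁ id) ∘ a-step A₀ t
      a-step-∘ˡ f t = trans (glue (sym (interchange f t)) (a-natural₁ f)) (assoc _ _ _)

      a⁻¹-step-∘ʳ : ∀ {y₀ y H L R} (t : Hom H (L • R)) (f : Hom y₀ y) →
                    a⁻¹-step y t ∘ (id •₁ f) ≡ (id •₁ (id •₁ f)) ∘ a⁻¹-step y₀ t
      a⁻¹-step-∘ʳ t f = trans (glue (interchange t f) (a⁻¹-natural₃ f)) (assoc _ _ _)

      a-step-natural : ∀ {A H L R C D} (g′ : Hom L C) (g″ : Hom R D) (t : Hom H (L • R)) →
                       a-step A ((g′ •₁ g″) ∘ t) ≡ ((id •₁ g′) •₁ g″) ∘ a-step A t
      a-step-natural g′ g″ t = begin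
        a-step _ ((g′ •₁ g″) ∘ t)                    ≡⟨ sym (a-step-∘ʳ (g′ •₁ g″) t) ⟩
        (a _ _ _ ∘ (id •₁ (g′ •₁ g″))) ∘ (id •₁ t)    ≡⟨ cong (_∘ (id •₁ t)) (a-natural id g′ g″) ⟩
        (((id •₁ g′) •₁ g″) ∘ a _ _ _) ∘ (id •₁ t)    ≡⟨ assoc _ _ _ ⟩
        ((id •₁ g′) •₁ g″) ∘ a-step _ t              ∎

      a⁻¹-step-natural : ∀ {y H L R C D} (g′ : Hom L C) (g″ : Hom R D) (t : Hom H (L • R)) →
                         a⁻¹-step y ((g′ •₁ g″) ∘ t) ≡ (g′ •₁ (g″ •₁ id)) ∘ a⁻¹-step y t
      a⁻¹-step-natural g′ g″ t = begin
        a⁻¹-step _ ((g′ •₁ g″) ∘ t)                    ≡⟨ sym (a⁻¹-step-∘ˡ (g′ •₁ g″) t) ⟩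
        (a⁻¹ _ _ _ ∘ ((g′ •₁ g″) •₁ id)) ∘ (t •₁ id)    ≡⟨ cong (_∘ (t •₁ id)) (a⁻¹-natural g′ g″ id) ⟩
        ((g′ •₁ (g″ •₁ id)) ∘ a⁻¹ _ _ _) ∘ (t •₁ id)    ≡⟨ assoc _ _ _ ⟩
        (g′ •₁ (g″ •₁ id)) ∘ a⁻¹-step _ t              ∎

      a-step-∘-a : ∀ {P Q H L R} (t : Hom H (L • R)) →
                   a-step (P • Q) t ∘ a P Q H ≡ (a P Q L •₁ id) ∘ a-step P (a-step Q t)
      a-step-∘-a {P} {Q} {L = L} {R} t = begin
        a-step (P • Q) t ∘ a P Q _
          ≡⟨ glue (sym (a-natural₃ t)) (pentagon P Q L R) ⟩
        ((a P Q L •₁ id) ∘ a-step P (a Q L R)) ∘ (id •₁ (id •₁ t))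
          ≡⟨ assoc _ _ _ ⟩
        (a P Q L •₁ id) ∘ (a-step P (a Q L R) ∘ (id •₁ (id •₁ t)))
          ≡⟨ cong ((a P Q L •₁ id) ∘_) (a-step-∘ʳ (a Q L R) (id •₁ t)) ⟩
        (a P Q L •₁ id) ∘ a-step P (a-step Q t)
          ∎

      a-step²-∘-a⁻¹ : ∀ {P Q H L R} (t : Hom H (L • R)) →
                      a-step P (a-step Q t) ∘ a⁻¹ P Q H ≡ (a⁻¹ P Q L •₁ id) ∘ a-step (P • Q) t
      a-step²-∘-a⁻¹ {P} {Q} {H} {L} t =
        sym (flip-square (a-step-∘-a t) (a∘a⁻¹ P Q H) (•-inverse (a⁻¹∘a P Q L) (identityˡ id)))

      a⁻¹-step-a-step-∘-a : ∀ {P H L R S} (t : Hom H (L • R)) →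
                            a⁻¹-step S (a-step P t) ∘ a P H S ≡ a-step P (a⁻¹-step S t)
      a⁻¹-step-a-step-∘-a {P} {H} {L} {R} {S} t = begin
        a⁻¹-step S (a-step P t) ∘ a P H S
          ≡⟨ cong (_∘ a P H S) (sym (a⁻¹-step-∘ˡ (a P L R) (id •₁ t))) ⟩
        (a⁻¹-step S (a P L R) ∘ ((id •₁ t) •₁ id)) ∘ a P H S
          ≡⟨ glue (sym (a-natural id t id)) coherence ⟩
        a-step P (a⁻¹ L R S) ∘ (id •₁ (t •₁ id))
          ≡⟨ a-step-∘ʳ (a⁻¹ L R S) (t •₁ id) ⟩
        a-step P (a⁻¹-step S t)
          ∎
        where
        coherence : a⁻¹-step S (a P L R) ∘ a P (L • R) S ≡ a-step P (a⁻¹ L R S)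
        coherence = trans (assoc _ _ _)
          (flip-square (trans (assoc _ _ _) (sym (pentagon P L R S)))
                       (•-inverse (identityˡ id) (a∘a⁻¹ L R S)) (a⁻¹∘a (P • L) R S))

      a-step-a⁻¹-step-∘-a⁻¹ : ∀ {P H L R S} (t : Hom H (L • R)) →
                              a-step P (a⁻¹-step S t) ∘ a⁻¹ P H S ≡ a⁻¹-step S (a-step P t)
      a-step-a⁻¹-step-∘-a⁻¹ {P} {H} {S = S} t =
        sym (flip-triangle (a⁻¹-step-a-step-∘-a t) (a∘a⁻¹ P H S))

      a⁻¹-step²-∘-a : ∀ {H L R Q S} (t : Hom H (L • R)) →
                      a⁻¹-step S (a⁻¹-step Q t) ∘ a H Q S ≡ (id •₁ a R Q S) ∘ a⁻¹-step (Q • S) t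
      a⁻¹-step²-∘-a {H} {L} {R} {Q} {S} t = begin
        a⁻¹-step S (a⁻¹-step Q t) ∘ a H Q S
          ≡⟨ cong (_∘ a H Q S) (sym (a⁻¹-step-∘ˡ (a⁻¹ L R Q) (t •₁ id))) ⟩
        (a⁻¹-step S (a⁻¹ L R Q) ∘ ((t •₁ id) •₁ id)) ∘ a H Q S
          ≡⟨ glue (sym (a-natural₁ t)) coherence ⟩
        ((id •₁ a R Q S) ∘ a⁻¹ L R (Q • S)) ∘ (t •₁ id)
          ≡⟨ assoc _ _ _ ⟩
        (id •₁ a R Q S) ∘ a⁻¹-step (Q • S) t
          ∎
        where
        coherence : a⁻¹-step S (a⁻¹ L R Q) ∘ a (L • R) Q S ≡ (id •₁ a R Q S) ∘ a⁻¹ L R (Q • S)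
        coherence = flip-square (trans (pentagon L R Q S) (sym (assoc _ _ _))) (a∘a⁻¹ L R (Q • S))
                      (∘-inverse (•-inverse (a⁻¹∘a L R Q) (identityˡ id)) (a⁻¹∘a L (R • Q) S))

      a⁻¹-step-∘-a⁻¹ : ∀ {H L R Q S} (t : Hom H (L • R)) →
                       a⁻¹-step (Q • S) t ∘ a⁻¹ H Q S ≡ (id •₁ a⁻¹ R Q S) ∘ a⁻¹-step S (a⁻¹-step Q t)
      a⁻¹-step-∘-a⁻¹ {H} {R = R} {Q} {S} t =
        sym (flip-square (a⁻¹-step²-∘-a t) (a∘a⁻¹ H Q S) (•-inverse (identityˡ id) (a⁻¹∘a R Q S)))

    record Split : Set (o ⊔ ℓ) where
      constructor split
      field
        {source left right} : Obj
        arrow : Hom source (left • right)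

    -- ⟦ c ⟧ L R is the split τ^{id}_u of L • R for the word-with-arguments c, so Analysis h
    -- says that h is Id-analysable.
    module Analyses {Context : Set o} (⟦_⟧ : Context → Obj → Obj → Split) where
      open Split

      data Analysis {C D : Obj} : ∀ {X} → Hom X (C • D) → Set (o ⊔ ℓ) where
        analysed : ∀ {L R} c (g′ : Hom (left (⟦ c ⟧ L R)) C) (g″ : Hom (right (⟦ c ⟧ L R)) D) →
                   Analysis ((g′ •₁ g″) ∘ arrow (⟦ c ⟧ L R))

      analysed-by : ∀ {L R C D} c {h : Hom (source (⟦ c ⟧ L R)) (C • D)}
                    (g′ : Hom (left (⟦ c ⟧ L R)) C) (g″ : Hom (right (⟦ c ⟧ L R)) D) →
                    h ≡ (g′ •₁ g″) ∘ arrow (⟦ c ⟧ L R) → Analysis h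
      analysed-by c g′ g″ refl = analysed c g′ g″

      analysed-id : ∀ {L R} c {h : Hom (source (⟦ c ⟧ L R)) (left (⟦ c ⟧ L R) • right (⟦ c ⟧ L R))} →
                    h ≡ arrow (⟦ c ⟧ L R) → Analysis h
      analysed-id {L} {R} c eq =
        analysed-by c id id (trans eq (sym (trans (cong (_∘ arrow (⟦ c ⟧ L R)) •-id) (identityˡ _))))

      analysis-postcompose : ∀ {C D C′ D′ X} {h : Hom X (C • D)} → Analysis h →
                             (k′ : Hom C C′) (k″ : Hom D D′) → Analysis ((k′ •₁ k″) ∘ h)
      analysis-postcompose (analysed {L} {R} c g′ g″) k′ k″ =
        analysed-by c (k′ ∘ g′) (k″ ∘ g″)
          (trans (sym (assoc _ _ _)) (cong (_∘ arrow (⟦ c ⟧ L R)) (sym (•-∘ k′ g′ k″ g″))))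

      Precomposable : ∀ {X T} → Hom X T → Set (o ⊔ ℓ)
      Precomposable {X} {T} a =
        ∀ {L R} c (e : T ≡ source (⟦ c ⟧ L R)) → Analysis (arrow (⟦ c ⟧ L R) ∘ subst (Hom X) e a)

      module Precomposition (precomposable : ∀ {X T} {a : Hom X T} → Atomic a → Precomposable a) where

        analysis-∘-atomic : ∀ {C D X X′} {h : Hom X′ (C • D)} {a : Hom X X′} →
                            Analysis h → Atomic a → Analysis (h ∘ a)
        analysis-∘-atomic (analysed c g′ g″) at =
          subst Analysis (sym (assoc _ _ _)) (analysis-postcompose (precomposable at c refl) g′ g″)

        analysis-∘-elementary : ∀ {C D X X′} {h : Hom X′ (C • D)} {f : Hom X X′} →
                                Analysis h → Elementary f → Analysis (h ∘ f)
        analysis-∘-elementary an el-id        = subst Analysis (sym (identityʳ _)) an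
        analysis-∘-elementary an (el-∘ at el) =
          subst Analysis (assoc _ _ _) (analysis-∘-elementary (analysis-∘-atomic an at) el)

  module ⊗ where
    open Bifunctor _⊗_ _⊗₁_ ⊗-id ⊗-∘ public
    open Associative α α⁻¹ α∘α⁻¹ α⁻¹∘α α-natural P1 public

  module ⊙ where
    open Bifunctor _⊙_ _⊙₁_ ⊙-id ⊙-∘ public
    open Associative ᾱ ᾱ⁻¹ ᾱ∘ᾱ⁻¹ ᾱ⁻¹∘ᾱ ᾱ-natural P8 public

  open ⊗ public using () renaming (a-step to α-step; a⁻¹-step to α⁻¹-step)
  open ⊙ public using () renaming (a-step to ᾱ-step; a⁻¹-step to ᾱ⁻¹-step)

  δˡ-natural₁ : ∀ {A A′ B C} (f : Hom A A′) →
                δˡ A′ B C ∘ (f ⊗₁ id) ≡ ((f ⊗₁ id) ⊙₁ id) ∘ δˡ A B C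
  δˡ-natural₁ f = trans (cong (λ k → δˡ _ _ _ ∘ (f ⊗₁ k)) (sym ⊙-id)) (δˡ-natural f id id)

  δˡ-natural₃ : ∀ {A B C C′} (h : Hom C C′) →
                δˡ A B C′ ∘ (id ⊗₁ (id ⊙₁ h)) ≡ (id ⊙₁ h) ∘ δˡ A B C
  δˡ-natural₃ h = trans (δˡ-natural id id h) (cong (λ k → (k ⊙₁ h) ∘ δˡ _ _ _) ⊗-id)

  δʳ-natural₁ : ∀ {A A′ B C} (f : Hom A A′) →
                δʳ A′ B C ∘ ((f ⊙₁ id) ⊗₁ id) ≡ (f ⊙₁ id) ∘ δʳ A B C
  δʳ-natural₁ f = trans (δʳ-natural f id id) (cong (λ k → (f ⊙₁ k) ∘ δʳ _ _ _) ⊗-id)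

  δʳ-natural₃ : ∀ {A B C C′} (h : Hom C C′) →
                δʳ A B C′ ∘ (id ⊗₁ h) ≡ (id ⊙₁ (id ⊗₁ h)) ∘ δʳ A B C
  δʳ-natural₃ h = trans (cong (λ k → δʳ _ _ _ ∘ (k ⊗₁ h)) (sym ⊙-id)) (δʳ-natural id id h)

  δˡ-step : ∀ A {H L R} → Hom H (L ⊙ R) → Hom (A ⊗ H) ((A ⊗ L) ⊙ R)
  δˡ-step A t = δˡ A _ _ ∘ (id ⊗₁ t)

  δʳ-step : ∀ y {H L R} → Hom H (L ⊙ R) → Hom (H ⊗ y) (L ⊙ (R ⊗ y))
  δʳ-step y t = δʳ _ _ y ∘ (t ⊗₁ id)

  δˡ-step-id : ∀ {A L R} → δˡ-step A (id {L ⊙ R}) ≡ δˡ A L R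
  δˡ-step-id = trans (cong (δˡ _ _ _ ∘_) ⊗-id) (identityʳ _)

  δʳ-step-id : ∀ {y L R} → δʳ-step y (id {L ⊙ R}) ≡ δʳ L R y
  δʳ-step-id = trans (cong (δʳ _ _ _ ∘_) ⊗-id) (identityʳ _)

  δˡ-step-∘ʳ : ∀ {A H H′ L R} (t : Hom H′ (L ⊙ R)) (g : Hom H H′) →
               δˡ-step A t ∘ (id ⊗₁ g) ≡ δˡ-step A (t ∘ g)
  δˡ-step-∘ʳ t g = trans (assoc _ _ _) (cong (δˡ _ _ _ ∘_) (sym (⊗.id•-∘ t g)))

  δʳ-step-∘ˡ : ∀ {y H H′ L R} (t : Hom H′ (L ⊙ R)) (g : Hom H H′) →
               δʳ-step y t ∘ (g ⊗₁ id) ≡ δʳ-step y (t ∘ g)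
  δʳ-step-∘ˡ t g = trans (assoc _ _ _) (cong (δʳ _ _ _ ∘_) (sym (⊗.∘-•id t g)))

  δˡ-step-∘ˡ : ∀ {A₀ A H L R} (f : Hom A₀ A) (t : Hom H (L ⊙ R)) →
               δˡ-step A t ∘ (f ⊗₁ id) ≡ ((f ⊗₁ id) ⊙₁ id) ∘ δˡ-step A₀ t
  δˡ-step-∘ˡ f t = trans (glue (sym (⊗.interchange f t)) (δˡ-natural₁ f)) (assoc _ _ _)

  δʳ-step-∘ʳ : ∀ {y₀ y H L R} (t : Hom H (L ⊙ R)) (f : Hom y₀ y) →
               δʳ-step y t ∘ (id ⊗₁ f) ≡ (id ⊙₁ (id ⊗₁ f)) ∘ δʳ-step y₀ t
  δʳ-step-∘ʳ t f = trans (glue (⊗.interchange t f) (δʳ-natural₃ f)) (assoc _ _ _)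

  δˡ-step-natural : ∀ {A H L R C D} (g′ : Hom L C) (g″ : Hom R D) (t : Hom H (L ⊙ R)) →
                    δˡ-step A ((g′ ⊙₁ g″) ∘ t) ≡ ((id ⊗₁ g′) ⊙₁ g″) ∘ δˡ-step A t
  δˡ-step-natural g′ g″ t = begin
    δˡ-step _ ((g′ ⊙₁ g″) ∘ t)                     ≡⟨ sym (δˡ-step-∘ʳ (g′ ⊙₁ g″) t) ⟩
    (δˡ _ _ _ ∘ (id ⊗₁ (g′ ⊙₁ g″))) ∘ (id ⊗₁ t)    ≡⟨ cong (_∘ (id ⊗₁ t)) (δˡ-natural id g′ g″) ⟩
    (((id ⊗₁ g′) ⊙₁ g″) ∘ δˡ _ _ _) ∘ (id ⊗₁ t)    ≡⟨ assoc _ _ _ ⟩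
    ((id ⊗₁ g′) ⊙₁ g″) ∘ δˡ-step _ t               ∎

  δʳ-step-natural : ∀ {y H L R C D} (g′ : Hom L C) (g″ : Hom R D) (t : Hom H (L ⊙ R)) →
                    δʳ-step y ((g′ ⊙₁ g″) ∘ t) ≡ (g′ ⊙₁ (g″ ⊗₁ id)) ∘ δʳ-step y t
  δʳ-step-natural g′ g″ t = begin
    δʳ-step _ ((g′ ⊙₁ g″) ∘ t)                     ≡⟨ sym (δʳ-step-∘ˡ (g′ ⊙₁ g″) t) ⟩
    (δʳ _ _ _ ∘ ((g′ ⊙₁ g″) ⊗₁ id)) ∘ (t ⊗₁ id)    ≡⟨ cong (_∘ (t ⊗₁ id)) (δʳ-natural g′ g″ id) ⟩
    ((g′ ⊙₁ (g″ ⊗₁ id)) ∘ δʳ _ _ _) ∘ (t ⊗₁ id)    ≡⟨ assoc _ _ _ ⟩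
    (g′ ⊙₁ (g″ ⊗₁ id)) ∘ δʳ-step _ t               ∎

  ᾱ-step-∘-δˡ : ∀ {P Q H L R} (t : Hom H (L ⊙ R)) →
                ᾱ-step (P ⊗ Q) t ∘ δˡ P Q H ≡ (δˡ P Q L ⊙₁ id) ∘ δˡ-step P (ᾱ-step Q t)
  ᾱ-step-∘-δˡ {P} {Q} {L = L} {R} t = begin
    ᾱ-step (P ⊗ Q) t ∘ δˡ P Q _
      ≡⟨ glue (sym (δˡ-natural₃ t)) (P4 P Q L R) ⟩
    ((δˡ P Q L ⊙₁ id) ∘ δˡ-step P (ᾱ Q L R)) ∘ (id ⊗₁ (id ⊙₁ t))
      ≡⟨ assoc _ _ _ ⟩
    (δˡ P Q L ⊙₁ id) ∘ (δˡ-step P (ᾱ Q L R) ∘ (id ⊗₁ (id ⊙₁ t)))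
      ≡⟨ cong ((δˡ P Q L ⊙₁ id) ∘_) (δˡ-step-∘ʳ (ᾱ Q L R) (id ⊙₁ t)) ⟩
    (δˡ P Q L ⊙₁ id) ∘ δˡ-step P (ᾱ-step Q t)
      ∎

  ᾱ-step-δˡ-step-∘-δʳ : ∀ {P Q H L R} (t : Hom H (L ⊙ R)) →
                        ᾱ-step P (δˡ-step Q t) ∘ δʳ P Q H ≡ (δʳ P Q L ⊙₁ id) ∘ δˡ-step (P ⊙ Q) t
  ᾱ-step-δˡ-step-∘-δʳ {P} {Q} {H} {L} {R} t = begin
    ᾱ-step P (δˡ-step Q t) ∘ δʳ P Q H
      ≡⟨ cong (_∘ δʳ P Q H) (sym (⊙.a-step-∘ʳ (δˡ Q L R) (id ⊗₁ t))) ⟩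
    (ᾱ-step P (δˡ Q L R) ∘ (id ⊙₁ (id ⊗₁ t))) ∘ δʳ P Q H
      ≡⟨ glue (sym (δʳ-natural₃ t)) (trans (assoc _ _ _) (sym (P6 P Q L R))) ⟩
    ((δʳ P Q L ⊙₁ id) ∘ δˡ (P ⊙ Q) L R) ∘ (id ⊗₁ t)
      ≡⟨ assoc _ _ _ ⟩
    (δʳ P Q L ⊙₁ id) ∘ δˡ-step (P ⊙ Q) t
      ∎

  ᾱ-step-δʳ-step-∘-δʳ : ∀ {P H L R S} (t : Hom H (L ⊙ R)) →
                        ᾱ-step P (δʳ-step S t) ∘ δʳ P H S ≡ δʳ-step S (ᾱ-step P t)
  ᾱ-step-δʳ-step-∘-δʳ {P} {H} {L} {R} {S} t = begin
    ᾱ-step P (δʳ-step S t) ∘ δʳ P H S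
      ≡⟨ cong (_∘ δʳ P H S) (sym (⊙.a-step-∘ʳ (δʳ L R S) (t ⊗₁ id))) ⟩
    (ᾱ-step P (δʳ L R S) ∘ (id ⊙₁ (t ⊗₁ id))) ∘ δʳ P H S
      ≡⟨ glue (sym (δʳ-natural id t id)) (trans (assoc _ _ _) (sym (P7 P L R S))) ⟩
    δʳ-step S (ᾱ P L R) ∘ ((id ⊙₁ t) ⊗₁ id)
      ≡⟨ δʳ-step-∘ˡ (ᾱ P L R) (id ⊙₁ t) ⟩
    δʳ-step S (ᾱ-step P t)
      ∎

  ᾱ⁻¹-step-δˡ-step-∘-δˡ : ∀ {P H L R S} (t : Hom H (L ⊙ R)) →
                          ᾱ⁻¹-step S (δˡ-step P t) ∘ δˡ P H S ≡ δˡ-step P (ᾱ⁻¹-step S t)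
  ᾱ⁻¹-step-δˡ-step-∘-δˡ {P} {H} {L} {R} {S} t = begin
    ᾱ⁻¹-step S (δˡ-step P t) ∘ δˡ P H S
      ≡⟨ cong (_∘ δˡ P H S) (sym (⊙.a⁻¹-step-∘ˡ (δˡ P L R) (id ⊗₁ t))) ⟩
    (ᾱ⁻¹-step S (δˡ P L R) ∘ ((id ⊗₁ t) ⊙₁ id)) ∘ δˡ P H S
      ≡⟨ glue (sym (δˡ-natural id t id)) coherence ⟩
    δˡ-step P (ᾱ⁻¹ L R S) ∘ (id ⊗₁ (t ⊙₁ id))
      ≡⟨ δˡ-step-∘ʳ (ᾱ⁻¹ L R S) (t ⊙₁ id) ⟩
    δˡ-step P (ᾱ⁻¹-step S t)
      ∎
    where
    coherence : ᾱ⁻¹-step S (δˡ P L R) ∘ δˡ P (L ⊙ R) S ≡ δˡ-step P (ᾱ⁻¹ L R S)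
    coherence = trans (assoc _ _ _)
      (flip-square (trans (assoc _ _ _) (sym (P4 P L R S)))
                   (⊗.•-inverse (identityˡ id) (ᾱ∘ᾱ⁻¹ L R S)) (ᾱ⁻¹∘ᾱ (P ⊗ L) R S))

  ᾱ⁻¹-step-δʳ-step-∘-δˡ : ∀ {H L R Q S} (t : Hom H (L ⊙ R)) →
                          ᾱ⁻¹-step S (δʳ-step Q t) ∘ δˡ H Q S ≡ (id ⊙₁ δˡ R Q S) ∘ δʳ-step (Q ⊙ S) t
  ᾱ⁻¹-step-δʳ-step-∘-δˡ {H} {L} {R} {Q} {S} t = begin
    ᾱ⁻¹-step S (δʳ-step Q t) ∘ δˡ H Q S
      ≡⟨ cong (_∘ δˡ H Q S) (sym (⊙.a⁻¹-step-∘ˡ (δʳ L R Q) (t ⊗₁ id))) ⟩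
    (ᾱ⁻¹-step S (δʳ L R Q) ∘ ((t ⊗₁ id) ⊙₁ id)) ∘ δˡ H Q S
      ≡⟨ glue (sym (δˡ-natural₁ t)) coherence ⟩
    ((id ⊙₁ δˡ R Q S) ∘ δʳ L R (Q ⊙ S)) ∘ (t ⊗₁ id)
      ≡⟨ assoc _ _ _ ⟩
    (id ⊙₁ δˡ R Q S) ∘ δʳ-step (Q ⊙ S) t
      ∎
    where
    coherence : ᾱ⁻¹-step S (δʳ L R Q) ∘ δˡ (L ⊙ R) Q S ≡ (id ⊙₁ δˡ R Q S) ∘ δʳ L R (Q ⊙ S)
    coherence = trans (assoc _ _ _)
      (trans (cong (ᾱ⁻¹ L (R ⊗ Q) S ∘_) (P6 L R Q S)) (cancelˡ (ᾱ⁻¹∘ᾱ L (R ⊗ Q) S)))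

  ᾱ⁻¹-step-∘-δʳ : ∀ {H L R Q S} (t : Hom H (L ⊙ R)) →
                  ᾱ⁻¹-step (Q ⊗ S) t ∘ δʳ H Q S ≡ (id ⊙₁ δʳ R Q S) ∘ δʳ-step S (ᾱ⁻¹-step Q t)
  ᾱ⁻¹-step-∘-δʳ {H} {L} {R} {Q} {S} t = begin
    ᾱ⁻¹-step (Q ⊗ S) t ∘ δʳ H Q S
      ≡⟨ glue (sym (δʳ-natural₁ t)) coherence ⟩
    ((id ⊙₁ δʳ R Q S) ∘ δʳ-step S (ᾱ⁻¹ L R Q)) ∘ ((t ⊙₁ id) ⊗₁ id)
      ≡⟨ assoc _ _ _ ⟩
    (id ⊙₁ δʳ R Q S) ∘ (δʳ-step S (ᾱ⁻¹ L R Q) ∘ ((t ⊙₁ id) ⊗₁ id))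
      ≡⟨ cong ((id ⊙₁ δʳ R Q S) ∘_) (δʳ-step-∘ˡ (ᾱ⁻¹ L R Q) (t ⊙₁ id)) ⟩
    (id ⊙₁ δʳ R Q S) ∘ δʳ-step S (ᾱ⁻¹-step Q t)
      ∎
    where
    coherence : ᾱ⁻¹ L R (Q ⊗ S) ∘ δʳ (L ⊙ R) Q S ≡ (id ⊙₁ δʳ R Q S) ∘ δʳ-step S (ᾱ⁻¹ L R Q)
    coherence = trans (flip-square (P7 L R Q S) (⊗.•-inverse (ᾱ∘ᾱ⁻¹ L R Q) (identityˡ id))
                                   (ᾱ⁻¹∘ᾱ L R (Q ⊗ S)))
                      (assoc _ _ _)

  δˡ-step-∘-α : ∀ {P Q H L R} (t : Hom H (L ⊙ R)) →
                δˡ-step (P ⊗ Q) t ∘ α P Q H ≡ (α P Q L ⊙₁ id) ∘ δˡ-step P (δˡ-step Q t)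
  δˡ-step-∘-α {P} {Q} {L = L} {R} t = begin
    δˡ-step (P ⊗ Q) t ∘ α P Q _
      ≡⟨ glue (sym (⊗.a-natural₃ t)) (P2 P Q L R) ⟩
    ((α P Q L ⊙₁ id) ∘ δˡ-step P (δˡ Q L R)) ∘ (id ⊗₁ (id ⊗₁ t))
      ≡⟨ assoc _ _ _ ⟩
    (α P Q L ⊙₁ id) ∘ (δˡ-step P (δˡ Q L R) ∘ (id ⊗₁ (id ⊗₁ t)))
      ≡⟨ cong ((α P Q L ⊙₁ id) ∘_) (δˡ-step-∘ʳ (δˡ Q L R) (id ⊗₁ t)) ⟩
    (α P Q L ⊙₁ id) ∘ δˡ-step P (δˡ-step Q t)
      ∎

  δˡ-step²-∘-α⁻¹ : ∀ {P Q H L R} (t : Hom H (L ⊙ R)) →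
                   δˡ-step P (δˡ-step Q t) ∘ α⁻¹ P Q H ≡ (α⁻¹ P Q L ⊙₁ id) ∘ δˡ-step (P ⊗ Q) t
  δˡ-step²-∘-α⁻¹ {P} {Q} {H} {L} t =
    sym (flip-square (δˡ-step-∘-α t) (α∘α⁻¹ P Q H) (⊙.•-inverse (α⁻¹∘α P Q L) (identityˡ id)))

  δʳ-step-δˡ-step-∘-α : ∀ {P H L R S} (t : Hom H (L ⊙ R)) →
                        δʳ-step S (δˡ-step P t) ∘ α P H S ≡ δˡ-step P (δʳ-step S t)
  δʳ-step-δˡ-step-∘-α {P} {H} {L} {R} {S} t = begin
    δʳ-step S (δˡ-step P t) ∘ α P H S
      ≡⟨ cong (_∘ α P H S) (sym (δʳ-step-∘ˡ (δˡ P L R) (id ⊗₁ t))) ⟩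
    (δʳ-step S (δˡ P L R) ∘ ((id ⊗₁ t) ⊗₁ id)) ∘ α P H S
      ≡⟨ glue (sym (α-natural id t id)) (trans (assoc _ _ _) (sym (P3 P L R S))) ⟩
    δˡ-step P (δʳ L R S) ∘ (id ⊗₁ (t ⊗₁ id))
      ≡⟨ δˡ-step-∘ʳ (δʳ L R S) (t ⊗₁ id) ⟩
    δˡ-step P (δʳ-step S t)
      ∎

  δˡ-step-δʳ-step-∘-α⁻¹ : ∀ {P H L R S} (t : Hom H (L ⊙ R)) →
                          δˡ-step P (δʳ-step S t) ∘ α⁻¹ P H S ≡ δʳ-step S (δˡ-step P t)
  δˡ-step-δʳ-step-∘-α⁻¹ {P} {H} {S = S} t =
    sym (flip-triangle (δʳ-step-δˡ-step-∘-α t) (α∘α⁻¹ P H S))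

  δʳ-step²-∘-α : ∀ {H L R Q S} (t : Hom H (L ⊙ R)) →
                 δʳ-step S (δʳ-step Q t) ∘ α H Q S ≡ (id ⊙₁ α R Q S) ∘ δʳ-step (Q ⊗ S) t
  δʳ-step²-∘-α {H} {L} {R} {Q} {S} t = begin
    δʳ-step S (δʳ-step Q t) ∘ α H Q S
      ≡⟨ cong (_∘ α H Q S) (sym (δʳ-step-∘ˡ (δʳ L R Q) (t ⊗₁ id))) ⟩
    (δʳ-step S (δʳ L R Q) ∘ ((t ⊗₁ id) ⊗₁ id)) ∘ α H Q S
      ≡⟨ glue (sym (⊗.a-natural₁ t)) (trans (assoc _ _ _) (sym (P5 L R Q S))) ⟩
    ((id ⊙₁ α R Q S) ∘ δʳ L R (Q ⊗ S)) ∘ (t ⊗₁ id)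
      ≡⟨ assoc _ _ _ ⟩
    (id ⊙₁ α R Q S) ∘ δʳ-step (Q ⊗ S) t
      ∎

  δʳ-step-∘-α⁻¹ : ∀ {H L R Q S} (t : Hom H (L ⊙ R)) →
                  δʳ-step (Q ⊗ S) t ∘ α⁻¹ H Q S ≡ (id ⊙₁ α⁻¹ R Q S) ∘ δʳ-step S (δʳ-step Q t)
  δʳ-step-∘-α⁻¹ {H} {R = R} {Q} {S} t =
    sym (flip-square (δʳ-step²-∘-α t) (α∘α⁻¹ H Q S) (⊙.•-inverse (identityˡ id) (α⁻¹∘α R Q S)))

module TensorAnalysis {o ℓ : Level} (𝒞 : LDCat o ℓ) (tidy : Tidy 𝒞) where
  open LDCat 𝒞
  open LDTheory 𝒞
  open Tidy tidy
  open LDCategoryProperties 𝒞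
  open ⊗.Split

  -- A word of 𝔜 with each argument stored next to its letter.  τ instead reads the argument
  -- of α⁻¹ off the end of its vector with init and last, which do not compute on _∷ʳ_;
  -- context-word translates back.
  data Context : Set o where
    ∙   : Context
    _◁_ : Obj → Context → Context
    _▷_ : Context → Obj → Context

  ⟦_⟧ : Context → Obj → Obj → ⊗.Split
  ⟦ ∙ ⟧     L R = ⊗.split (id {L ⊗ R})
  ⟦ A ◁ c ⟧ L R = ⊗.split (α-step A (arrow (⟦ c ⟧ L R)))
  ⟦ c ▷ y ⟧ L R = ⊗.split (α⁻¹-step y (arrow (⟦ c ⟧ L R)))

  open ⊗.Analyses ⟦_⟧

  analysis-α-step : ∀ A {C D X} {h : Hom X (C ⊗ D)} → Analysis h → Analysis (α-step A h)
  analysis-α-step A (analysed c g′ g″) =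
    analysed-by (A ◁ c) (id ⊗₁ g′) g″ (⊗.a-step-natural g′ g″ _)

  analysis-α⁻¹-step : ∀ y {C D X} {h : Hom X (C ⊗ D)} → Analysis h → Analysis (α⁻¹-step y h)
  analysis-α⁻¹-step y (analysed c g′ g″) =
    analysed-by (c ▷ y) g′ (g″ ⊗₁ id) (⊗.a⁻¹-step-natural g′ g″ _)

  data SourceView {L R : Obj} (X Y : Obj) : Context → Set o where
    ∙-source : X ≡ L → Y ≡ R → SourceView X Y ∙
    ◁-source : ∀ {A c} → X ≡ A → Y ≡ source (⟦ c ⟧ L R) → SourceView X Y (A ◁ c)
    ▷-source : ∀ {c y} → X ≡ source (⟦ c ⟧ L R) → Y ≡ y → SourceView X Y (c ▷ y)

  source-view : ∀ {L R X Y} c → X ⊗ Y ≡ source (⟦ c ⟧ L R) → SourceView {L} {R} X Y c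
  source-view ∙       e = uncurry ∙-source (⊗-inj e)
  source-view (A ◁ c) e = uncurry ◁-source (⊗-inj e)
  source-view (c ▷ y) e = uncurry ▷-source (⊗-inj e)

  α-precomposable : ∀ P Q S → Precomposable (α P Q S)
  α-precomposable P Q S c e with source-view c e
  ... | ∙-source refl refl with refl ← e =
    analysed-id (P ◁ ∙) (trans (identityˡ _) (sym ⊗.a-step-id))
  ... | ◁-source {c = c′} refl refl with refl ← e =
    analysed-by (P ◁ (Q ◁ c′)) (α P Q _) id (⊗.a-step-∘-a _)
  ... | ▷-source {c = c′} eq refl with source-view c′ eq
  ...   | ∙-source refl refl with refl ← e =
    analysed-id ∙ ⊗.a⁻¹-step-id-∘-a
  ...   | ◁-source {c = c″} refl refl with refl ← e =
    analysed-id (P ◁ (c″ ▷ S)) (⊗.a⁻¹-step-a-step-∘-a _)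
  ...   | ▷-source {c = c″} refl refl with refl ← e =
    analysed-by (c″ ▷ (Q ⊗ S)) id (α _ Q S) (⊗.a⁻¹-step²-∘-a _)

  α⁻¹-precomposable : ∀ P Q S → Precomposable (α⁻¹ P Q S)
  α⁻¹-precomposable P Q S c e with source-view c e
  ... | ∙-source refl refl with refl ← e =
    analysed-id (∙ ▷ S) (trans (identityˡ _) (sym ⊗.a⁻¹-step-id))
  ... | ▷-source {c = c′} refl refl with refl ← e =
    analysed-by ((c′ ▷ Q) ▷ S) id (α⁻¹ _ Q S) (⊗.a⁻¹-step-∘-a⁻¹ _)
  ... | ◁-source {c = c′} refl eq with source-view c′ eq
  ...   | ∙-source refl refl with refl ← e =
    analysed-id ∙ ⊗.a-step-id-∘-a⁻¹
  ...   | ◁-source {c = c″} refl refl with refl ← e =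
    analysed-by ((P ⊗ Q) ◁ c″) (α⁻¹ P Q _) id (⊗.a-step²-∘-a⁻¹ _)
  ...   | ▷-source {c = c″} refl refl with refl ← e =
    analysed-id ((P ◁ c″) ▷ S) (⊗.a-step-a⁻¹-step-∘-a⁻¹ _)

  ⊗id-precomposable : ∀ X {A B} {f : Hom A B} → Precomposable f → Precomposable (f ⊗₁ id {X})
  ⊗id-precomposable X {f = f} f-precomposable c e with source-view c e
  ... | ∙-source refl refl with refl ← e =
    analysed-by ∙ f id (trans (identityˡ _) (sym (identityʳ _)))
  ... | ◁-source {c = c′} refl refl with refl ← e =
    analysed-by (_ ◁ c′) (f ⊗₁ id) id (⊗.a-step-∘ˡ f _)
  ... | ▷-source {c = c′} refl refl with refl ← e =
    subst Analysis (sym (⊗.a⁻¹-step-∘ˡ _ f)) (analysis-α⁻¹-step X (f-precomposable c′ refl))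

  id⊗-precomposable : ∀ X {A B} {f : Hom A B} → Precomposable f → Precomposable (id {X} ⊗₁ f)
  id⊗-precomposable X {f = f} f-precomposable c e with source-view c e
  ... | ∙-source refl refl with refl ← e =
    analysed-by ∙ id f (trans (identityˡ _) (sym (identityʳ _)))
  ... | ◁-source {c = c′} refl refl with refl ← e =
    subst Analysis (sym (⊗.a-step-∘ʳ _ f)) (analysis-α-step X (f-precomposable c′ refl))
  ... | ▷-source {c = c′} refl refl with refl ← e =
    analysed-by (c′ ▷ _) id (id ⊗₁ f) (⊗.a⁻¹-step-∘ʳ _ f)

  -- Vacuously, as the source of a context is a ⊗-product.
  into-⊙-precomposable : ∀ {X Y Z} {a : Hom X (Y ⊙ Z)} → Precomposable a
  into-⊙-precomposable ∙       e = ⊥-elim (⊗≢⊙ (sym e))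
  into-⊙-precomposable (A ◁ c) e = ⊥-elim (⊗≢⊙ (sym e))
  into-⊙-precomposable (c ▷ y) e = ⊥-elim (⊗≢⊙ (sym e))

  precomposable : ∀ {X T} {a : Hom X T} → Atomic a → Precomposable a
  precomposable (at-α P Q S)   = α-precomposable P Q S
  precomposable (at-α⁻¹ P Q S) = α⁻¹-precomposable P Q S
  precomposable (at-⊗ʳ X at)   = ⊗id-precomposable X (precomposable at)
  precomposable (at-⊗ˡ X at)   = id⊗-precomposable X (precomposable at)
  precomposable (at-ᾱ P Q S)   = into-⊙-precomposable
  precomposable (at-ᾱ⁻¹ P Q S) = into-⊙-precomposable
  precomposable (at-δˡ P Q S)  = into-⊙-precomposable
  precomposable (at-δʳ P Q S)  = into-⊙-precomposable
  precomposable (at-⊙ʳ X at)   = into-⊙-precomposable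
  precomposable (at-⊙ˡ X at)   = into-⊙-precomposable

  open Precomposition precomposable

  context-word : ∀ {L R} c →
                 Σ[ u ∈ List YGen ] Σ[ As ∈ Vec Obj (length u) ] ⊗.split (τ (id {L ⊗ R}) u As) ≡ ⟦ c ⟧ L R
  context-word ∙ = [] , [] , refl
  context-word (A ◁ c) with context-word c
  ... | u , As , eq = gα ∷ u , A ∷ As , cong (λ s → ⊗.split (α-step A (arrow s))) eq
  context-word (c ▷ y) with context-word c
  ... | u , As , eq = gα⁻¹ ∷ u , As ∷ʳ y ,
    trans (cong₂ (λ Bs z → ⊗.split (α⁻¹-step z (τ id u Bs))) (init-∷ʳ y As) (last-∷ʳ y As))
          (cong (λ s → ⊗.split (α⁻¹-step y (arrow s))) eq)

  word-analysable : ∀ {L R C D} u (As : Vec Obj (length u)) {s : ⊗.Split} →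
                    ⊗.split (τ (id {L ⊗ R}) u As) ≡ s →
                    (g′ : Hom (left s) C) (g″ : Hom (right s) D) →
                    Analysable⊗ Id⊗ ((g′ ⊗₁ g″) ∘ arrow s)
  word-analysable u As refl g′ g″ = analyse id isId u As g′ g″

  analysable : ∀ {C D X} {h : Hom X (C ⊗ D)} → Analysis h → Analysable⊗ Id⊗ h
  analysable (analysed {L} {R} c g′ g″) with context-word {L} {R} c
  ... | u , As , eq = word-analysable u As eq g′ g″

  elementary-analysable : ∀ {X Y} {f : Hom X Y} → Elementary f → IsOtimesProduct Y → Analysable⊗ Id⊗ f
  elementary-analysable el (C , D , refl) =
    analysable (subst Analysis (identityˡ _) (analysis-∘-elementary (analysed-id ∙ refl) el))

module ParAnalysis {o ℓ : Level} (𝒞 : LDCat o ℓ) (tidy : Tidy 𝒞) where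
  open LDCat 𝒞
  open LDTheory 𝒞
  open Tidy tidy
  open LDCategoryProperties 𝒞
  open ⊙.Split

  data Context : Set o where
    ∙   : Context
    _◁_ : Obj → Context → Context
    _▷_ : Context → Obj → Context
    _◀_ : Obj → Context → Context
    _▶_ : Context → Obj → Context

  ⟦_⟧ : Context → Obj → Obj → ⊙.Split
  ⟦ ∙ ⟧     L R = ⊙.split (id {L ⊙ R})
  ⟦ A ◁ c ⟧ L R = ⊙.split (ᾱ-step A (arrow (⟦ c ⟧ L R)))
  ⟦ c ▷ y ⟧ L R = ⊙.split (ᾱ⁻¹-step y (arrow (⟦ c ⟧ L R)))
  ⟦ A ◀ c ⟧ L R = ⊙.split (δˡ-step A (arrow (⟦ c ⟧ L R)))
  ⟦ c ▶ y ⟧ L R = ⊙.split (δʳ-step y (arrow (⟦ c ⟧ L R)))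

  open ⊙.Analyses ⟦_⟧

  analysis-ᾱ-step : ∀ A {C D X} {h : Hom X (C ⊙ D)} → Analysis h → Analysis (ᾱ-step A h)
  analysis-ᾱ-step A (analysed c g′ g″) =
    analysed-by (A ◁ c) (id ⊙₁ g′) g″ (⊙.a-step-natural g′ g″ _)

  analysis-ᾱ⁻¹-step : ∀ y {C D X} {h : Hom X (C ⊙ D)} → Analysis h → Analysis (ᾱ⁻¹-step y h)
  analysis-ᾱ⁻¹-step y (analysed c g′ g″) =
    analysed-by (c ▷ y) g′ (g″ ⊙₁ id) (⊙.a⁻¹-step-natural g′ g″ _)

  analysis-δˡ-step : ∀ A {C D X} {h : Hom X (C ⊙ D)} → Analysis h → Analysis (δˡ-step A h)
  analysis-δˡ-step A (analysed c g′ g″) =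
    analysed-by (A ◀ c) (id ⊗₁ g′) g″ (δˡ-step-natural g′ g″ _)

  analysis-δʳ-step : ∀ y {C D X} {h : Hom X (C ⊙ D)} → Analysis h → Analysis (δʳ-step y h)
  analysis-δʳ-step y (analysed c g′ g″) =
    analysed-by (c ▶ y) g′ (g″ ⊗₁ id) (δʳ-step-natural g′ g″ _)

  data ⊙-SourceView {L R : Obj} (X Y : Obj) : Context → Set o where
    ∙-source : X ≡ L → Y ≡ R → ⊙-SourceView X Y ∙
    ◁-source : ∀ {A c} → X ≡ A → Y ≡ source (⟦ c ⟧ L R) → ⊙-SourceView X Y (A ◁ c)
    ▷-source : ∀ {c y} → X ≡ source (⟦ c ⟧ L R) → Y ≡ y → ⊙-SourceView X Y (c ▷ y)

  data ⊗-SourceView {L R : Obj} (X Y : Obj) : Context → Set o where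
    ◀-source : ∀ {A c} → X ≡ A → Y ≡ source (⟦ c ⟧ L R) → ⊗-SourceView X Y (A ◀ c)
    ▶-source : ∀ {c y} → X ≡ source (⟦ c ⟧ L R) → Y ≡ y → ⊗-SourceView X Y (c ▶ y)

  ⊙-source-view : ∀ {L R X Y} c → X ⊙ Y ≡ source (⟦ c ⟧ L R) → ⊙-SourceView {L} {R} X Y c
  ⊙-source-view ∙       e = uncurry ∙-source (⊙-inj e)
  ⊙-source-view (A ◁ c) e = uncurry ◁-source (⊙-inj e)
  ⊙-source-view (c ▷ y) e = uncurry ▷-source (⊙-inj e)
  ⊙-source-view (A ◀ c) e = ⊥-elim (⊗≢⊙ (sym e))
  ⊙-source-view (c ▶ y) e = ⊥-elim (⊗≢⊙ (sym e))

  ⊗-source-view : ∀ {L R X Y} c → X ⊗ Y ≡ source (⟦ c ⟧ L R) → ⊗-SourceView {L} {R} X Y c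
  ⊗-source-view ∙       e = ⊥-elim (⊗≢⊙ e)
  ⊗-source-view (A ◁ c) e = ⊥-elim (⊗≢⊙ e)
  ⊗-source-view (c ▷ y) e = ⊥-elim (⊗≢⊙ e)
  ⊗-source-view (A ◀ c) e = uncurry ◀-source (⊗-inj e)
  ⊗-source-view (c ▶ y) e = uncurry ▶-source (⊗-inj e)

  ᾱ-precomposable : ∀ P Q S → Precomposable (ᾱ P Q S)
  ᾱ-precomposable P Q S c e with ⊙-source-view c e
  ... | ∙-source refl refl with refl ← e =
    analysed-id (P ◁ ∙) (trans (identityˡ _) (sym ⊙.a-step-id))
  ... | ◁-source {c = c′} refl refl with refl ← e =
    analysed-by (P ◁ (Q ◁ c′)) (ᾱ P Q _) id (⊙.a-step-∘-a _)
  ... | ▷-source {c = c′} eq refl with ⊙-source-view c′ eq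
  ...   | ∙-source refl refl with refl ← e =
    analysed-id ∙ ⊙.a⁻¹-step-id-∘-a
  ...   | ◁-source {c = c″} refl refl with refl ← e =
    analysed-id (P ◁ (c″ ▷ S)) (⊙.a⁻¹-step-a-step-∘-a _)
  ...   | ▷-source {c = c″} refl refl with refl ← e =
    analysed-by (c″ ▷ (Q ⊙ S)) id (ᾱ _ Q S) (⊙.a⁻¹-step²-∘-a _)

  ᾱ⁻¹-precomposable : ∀ P Q S → Precomposable (ᾱ⁻¹ P Q S)
  ᾱ⁻¹-precomposable P Q S c e with ⊙-source-view c e
  ... | ∙-source refl refl with refl ← e =
    analysed-id (∙ ▷ S) (trans (identityˡ _) (sym ⊙.a⁻¹-step-id))
  ... | ▷-source {c = c′} refl refl with refl ← e =
    analysed-by ((c′ ▷ Q) ▷ S) id (ᾱ⁻¹ _ Q S) (⊙.a⁻¹-step-∘-a⁻¹ _)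
  ... | ◁-source {c = c′} refl eq with ⊙-source-view c′ eq
  ...   | ∙-source refl refl with refl ← e =
    analysed-id ∙ ⊙.a-step-id-∘-a⁻¹
  ...   | ◁-source {c = c″} refl refl with refl ← e =
    analysed-by ((P ⊙ Q) ◁ c″) (ᾱ⁻¹ P Q _) id (⊙.a-step²-∘-a⁻¹ _)
  ...   | ▷-source {c = c″} refl refl with refl ← e =
    analysed-id ((P ◁ c″) ▷ S) (⊙.a-step-a⁻¹-step-∘-a⁻¹ _)

  δˡ-precomposable : ∀ P Q S → Precomposable (δˡ P Q S)
  δˡ-precomposable P Q S c e with ⊙-source-view c e
  ... | ∙-source refl refl with refl ← e =
    analysed-id (P ◀ ∙) (trans (identityˡ _) (sym δˡ-step-id))
  ... | ◁-source {c = c′} refl refl with refl ← e =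
    analysed-by (P ◀ (Q ◁ c′)) (δˡ P Q _) id (ᾱ-step-∘-δˡ _)
  ... | ▷-source {c = c′} eq refl with ⊗-source-view c′ eq
  ...   | ◀-source {c = c″} refl refl with refl ← e =
    analysed-id (P ◀ (c″ ▷ S)) (ᾱ⁻¹-step-δˡ-step-∘-δˡ _)
  ...   | ▶-source {c = c″} refl refl with refl ← e =
    analysed-by (c″ ▶ (Q ⊙ S)) id (δˡ _ Q S) (ᾱ⁻¹-step-δʳ-step-∘-δˡ _)

  δʳ-precomposable : ∀ P Q S → Precomposable (δʳ P Q S)
  δʳ-precomposable P Q S c e with ⊙-source-view c e
  ... | ∙-source refl refl with refl ← e =
    analysed-id (∙ ▶ S) (trans (identityˡ _) (sym δʳ-step-id))
  ... | ▷-source {c = c′} refl refl with refl ← e =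
    analysed-by ((c′ ▷ Q) ▶ S) id (δʳ _ Q S) (ᾱ⁻¹-step-∘-δʳ _)
  ... | ◁-source {c = c′} refl eq with ⊗-source-view c′ eq
  ...   | ◀-source {c = c″} refl refl with refl ← e =
    analysed-by ((P ⊙ Q) ◀ c″) (δʳ P Q _) id (ᾱ-step-δˡ-step-∘-δʳ _)
  ...   | ▶-source {c = c″} refl refl with refl ← e =
    analysed-id ((P ◁ c″) ▶ S) (ᾱ-step-δʳ-step-∘-δʳ _)

  α-precomposable : ∀ P Q S → Precomposable (α P Q S)
  α-precomposable P Q S c e with ⊗-source-view c e
  ... | ◀-source {c = c′} refl refl with refl ← e =
    analysed-by (P ◀ (Q ◀ c′)) (α P Q _) id (δˡ-step-∘-α _)
  ... | ▶-source {c = c′} eq refl with ⊗-source-view c′ eq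
  ...   | ◀-source {c = c″} refl refl with refl ← e =
    analysed-id (P ◀ (c″ ▶ S)) (δʳ-step-δˡ-step-∘-α _)
  ...   | ▶-source {c = c″} refl refl with refl ← e =
    analysed-by (c″ ▶ (Q ⊗ S)) id (α _ Q S) (δʳ-step²-∘-α _)

  α⁻¹-precomposable : ∀ P Q S → Precomposable (α⁻¹ P Q S)
  α⁻¹-precomposable P Q S c e with ⊗-source-view c e
  ... | ▶-source {c = c′} refl refl with refl ← e =
    analysed-by ((c′ ▶ Q) ▶ S) id (α⁻¹ _ Q S) (δʳ-step-∘-α⁻¹ _)
  ... | ◀-source {c = c′} refl eq with ⊗-source-view c′ eq
  ...   | ◀-source {c = c″} refl refl with refl ← e =
    analysed-by ((P ⊗ Q) ◀ c″) (α⁻¹ P Q _) id (δˡ-step²-∘-α⁻¹ _)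
  ...   | ▶-source {c = c″} refl refl with refl ← e =
    analysed-id ((P ◀ c″) ▶ S) (δˡ-step-δʳ-step-∘-α⁻¹ _)

  ⊙id-precomposable : ∀ X {A B} {f : Hom A B} → Precomposable f → Precomposable (f ⊙₁ id {X})
  ⊙id-precomposable X {f = f} f-precomposable c e with ⊙-source-view c e
  ... | ∙-source refl refl with refl ← e =
    analysed-by ∙ f id (trans (identityˡ _) (sym (identityʳ _)))
  ... | ◁-source {c = c′} refl refl with refl ← e =
    analysed-by (_ ◁ c′) (f ⊙₁ id) id (⊙.a-step-∘ˡ f _)
  ... | ▷-source {c = c′} refl refl with refl ← e =
    subst Analysis (sym (⊙.a⁻¹-step-∘ˡ _ f)) (analysis-ᾱ⁻¹-step X (f-precomposable c′ refl))

  id⊙-precomposable : ∀ X {A B} {f : Hom A B} → Precomposable f → Precomposable (id {X} ⊙₁ f)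
  id⊙-precomposable X {f = f} f-precomposable c e with ⊙-source-view c e
  ... | ∙-source refl refl with refl ← e =
    analysed-by ∙ id f (trans (identityˡ _) (sym (identityʳ _)))
  ... | ◁-source {c = c′} refl refl with refl ← e =
    subst Analysis (sym (⊙.a-step-∘ʳ _ f)) (analysis-ᾱ-step X (f-precomposable c′ refl))
  ... | ▷-source {c = c′} refl refl with refl ← e =
    analysed-by (c′ ▷ _) id (id ⊙₁ f) (⊙.a⁻¹-step-∘ʳ _ f)

  ⊗id-precomposable : ∀ X {A B} {f : Hom A B} → Precomposable f → Precomposable (f ⊗₁ id {X})
  ⊗id-precomposable X {f = f} f-precomposable c e with ⊗-source-view c e
  ... | ◀-source {c = c′} refl refl with refl ← e =
    analysed-by (_ ◀ c′) (f ⊗₁ id) id (δˡ-step-∘ˡ f _)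
  ... | ▶-source {c = c′} refl refl with refl ← e =
    subst Analysis (sym (δʳ-step-∘ˡ _ f)) (analysis-δʳ-step X (f-precomposable c′ refl))

  id⊗-precomposable : ∀ X {A B} {f : Hom A B} → Precomposable f → Precomposable (id {X} ⊗₁ f)
  id⊗-precomposable X {f = f} f-precomposable c e with ⊗-source-view c e
  ... | ◀-source {c = c′} refl refl with refl ← e =
    subst Analysis (sym (δˡ-step-∘ʳ _ f)) (analysis-δˡ-step X (f-precomposable c′ refl))
  ... | ▶-source {c = c′} refl refl with refl ← e =
    analysed-by (c′ ▶ _) id (id ⊗₁ f) (δʳ-step-∘ʳ _ f)

  precomposable : ∀ {X T} {a : Hom X T} → Atomic a → Precomposable a
  precomposable (at-ᾱ P Q S)   = ᾱ-precomposable P Q S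
  precomposable (at-ᾱ⁻¹ P Q S) = ᾱ⁻¹-precomposable P Q S
  precomposable (at-δˡ P Q S)  = δˡ-precomposable P Q S
  precomposable (at-δʳ P Q S)  = δʳ-precomposable P Q S
  precomposable (at-α P Q S)   = α-precomposable P Q S
  precomposable (at-α⁻¹ P Q S) = α⁻¹-precomposable P Q S
  precomposable (at-⊙ʳ X at)   = ⊙id-precomposable X (precomposable at)
  precomposable (at-⊙ˡ X at)   = id⊙-precomposable X (precomposable at)
  precomposable (at-⊗ʳ X at)   = ⊗id-precomposable X (precomposable at)
  precomposable (at-⊗ˡ X at)   = id⊗-precomposable X (precomposable at)

  open Precomposition precomposable

  context-word : ∀ {L R} c →
                 Σ[ u ∈ List ZGen ] Σ[ As ∈ Vec Obj (length u) ] ⊙.split (κ (id {L ⊙ R}) u As) ≡ ⟦ c ⟧ L R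
  context-word ∙ = [] , [] , refl
  context-word (A ◁ c) with context-word c
  ... | u , As , eq = gᾱ ∷ u , A ∷ As , cong (λ s → ⊙.split (ᾱ-step A (arrow s))) eq
  context-word (A ◀ c) with context-word c
  ... | u , As , eq = gδˡ ∷ u , A ∷ As , cong (λ s → ⊙.split (δˡ-step A (arrow s))) eq
  context-word (c ▷ y) with context-word c
  ... | u , As , eq = gᾱ⁻¹ ∷ u , As ∷ʳ y ,
    trans (cong₂ (λ Bs z → ⊙.split (ᾱ⁻¹-step z (κ id u Bs))) (init-∷ʳ y As) (last-∷ʳ y As))
          (cong (λ s → ⊙.split (ᾱ⁻¹-step y (arrow s))) eq)
  context-word (c ▶ y) with context-word c
  ... | u , As , eq = gδʳ ∷ u , As ∷ʳ y ,
    trans (cong₂ (λ Bs z → ⊙.split (δʳ-step z (κ id u Bs))) (init-∷ʳ y As) (last-∷ʳ y As))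
          (cong (λ s → ⊙.split (δʳ-step y (arrow s))) eq)

  word-analysable : ∀ {L R C D} u (As : Vec Obj (length u)) {s : ⊙.Split} →
                    ⊙.split (κ (id {L ⊙ R}) u As) ≡ s →
                    (g′ : Hom (left s) C) (g″ : Hom (right s) D) →
                    Analysable⊙ Id⊙ ((g′ ⊙₁ g″) ∘ arrow s)
  word-analysable u As refl g′ g″ = analyse id isId u As g′ g″

  analysable : ∀ {C D X} {h : Hom X (C ⊙ D)} → Analysis h → Analysable⊙ Id⊙ h
  analysable (analysed {L} {R} c g′ g″) with context-word {L} {R} c
  ... | u , As , eq = word-analysable u As eq g′ g″

  elementary-analysable : ∀ {X Y} {f : Hom X Y} → Elementary f → IsOdotProduct Y → Analysable⊙ Id⊙ f
  elementary-analysable el (C , D , refl) =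
    analysable (subst Analysis (identityˡ _) (analysis-∘-elementary (analysed-id ∙ refl) el))

module _ {o ℓ : Level} (𝒞 : LDCat o ℓ) where
  open LDCat 𝒞
  open LDTheory 𝒞

  atomic-target : ∀ {A B} {g : Hom A B} → Atomic g → IsOtimesProduct B ⊎ IsOdotProduct B
  atomic-target (at-α A B C)          = inj₁ (A ⊗ B , C , refl)
  atomic-target (at-α⁻¹ A B C)        = inj₁ (A , B ⊗ C , refl)
  atomic-target (at-ᾱ A B C)          = inj₂ (A ⊙ B , C , refl)
  atomic-target (at-ᾱ⁻¹ A B C)        = inj₂ (A , B ⊙ C , refl)
  atomic-target (at-δˡ A B C)         = inj₂ (A ⊗ B , C , refl)
  atomic-target (at-δʳ A B C)         = inj₂ (A , B ⊗ C , refl)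
  atomic-target (at-⊗ʳ {B = B} X _)   = inj₁ (B , X , refl)
  atomic-target (at-⊗ˡ {B = B} X _)   = inj₁ (X , B , refl)
  atomic-target (at-⊙ʳ {B = B} X _)   = inj₂ (B , X , refl)
  atomic-target (at-⊙ˡ {B = B} X _)   = inj₂ (X , B , refl)

  elementary-into-non-product : ∀ {X Y} {f : Hom X Y} → Elementary f →
                                (¬ IsOtimesProduct Y) × (¬ IsOdotProduct Y) → IsId f
  elementary-into-non-product el-id        _                = isId
  elementary-into-non-product (el-∘ at _) (not-⊗ , not-⊙) with atomic-target at
  ... | inj₁ is-⊗ = ⊥-elim (not-⊗ is-⊗)
  ... | inj₂ is-⊙ = ⊥-elim (not-⊙ is-⊙)

proposition4p8 : ∀ {o ℓ : Level} (𝒞 : LDCat o ℓ) → Tidy 𝒞 →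
    let open LDCat 𝒞
        open LDTheory 𝒞
    in ∀ {X Y : Obj} (f : Hom X Y) → Elementary f →
       (((¬ IsOtimesProduct Y) × (¬ IsOdotProduct Y) → IsId f)
        × (IsOtimesProduct Y → Analysable⊗ Id⊗ f)
        × (IsOdotProduct Y → Analysable⊙ Id⊙ f))
proposition4p8 𝒞 tidy f el =
  elementary-into-non-product 𝒞 el ,
  TensorAnalysis.elementary-analysable 𝒞 tidy el ,
  ParAnalysis.elementary-analysable 𝒞 tidy el
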